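{- Let $m\ge 0$ and let $n,k$ be integers with $0\le n,k<4\cdot 3^m$. Then $$\binom{n+4\cdot 3^m}{k}_F\equiv\begin{cases}\binom{n}{k}_F & \text{if } k \text{ is even},\\ -\binom{n}{k}_F & \text{if } k\text{ is odd},\end{cases}\pmod 3,$$ $$\binom{n+8\cdot 3^m}{k}_F\equiv\binom{n}{k}_F\pmod 3,$$ and $$\binom{n+8\cdot 3^m}{k+4\cdot 3^m}_F\equiv\begin{cases}-\binom{n}{k}_F & \text{if } n \text{ is even},\\ \binom{n}{k}_F & \text{if } n\text{ is odd},\end{cases}\pmod 3.$$
   Context: The Fibonacci numbers are defined by $F_0=0$, $F_1=1$, $F_n=F_{n-1}+F_{n-2}$ for $n\ge 2$; $n!_F=F_1\cdots F_n$ ($0!_F=1$) and $\binom{n}{k}_F=\frac{n!_F}{k!_F(n-k)!_F}$ for $0\le k\le n$, with $\binom{n}{k}_F=0$ for $k<0$ or $k>n$. -}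

module Defs where

open import Data.Nat using (ℕ; zero; suc; _+_; _*_; _∸_; _/_; _≤?_; NonZero; >-nonZero)
open import Data.Nat.Properties using (m*n≢0)
open import Data.Integer as ℤ using (ℤ; +_)
open import Data.Integer.Divisibility using (_∣_)
open import Relation.Nullary using (yes; no)

fib : ℕ → ℕ
fib 0 = 0
fib 1 = 1
fib (suc (suc n)) = fib (suc n) + fib n

fib-suc-pos : ∀ n → NonZero (fib (suc n))
fib-suc-pos zero = _
fib-suc-pos (suc n) = helper (fib (suc n)) (fib n) (fib-suc-pos n)
  where
  helper : ∀ a b → NonZero a → NonZero (a + b)
  helper (suc a) b _ = _

fibFact : ℕ → ℕ
fibFact zero = 1
fibFact (suc n) = fib (suc n) * fibFact n

fibFact-nz : ∀ n → NonZero (fibFact n)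
fibFact-nz zero = _
fibFact-nz (suc n) = m*n≢0 (fib (suc n)) (fibFact n) {{fib-suc-pos n}} {{fibFact-nz n}}

-- Fibonomial coefficient  n!_F / (k!_F (n-k)!_F)  for k ≤ n, and 0 for k > n
-- (the division is exact; this is the paper's definition)
fibonomial : ℕ → ℕ → ℕ
fibonomial n k with k ≤? n
... | yes _ = _/_ (fibFact n) (fibFact k * fibFact (n ∸ k))
                {{m*n≢0 (fibFact k) (fibFact (n ∸ k)) {{fibFact-nz k}} {{fibFact-nz (n ∸ k)}}}}
... | no _ = 0

_≡_[mod_] : ℤ → ℤ → ℕ → Set
a ≡ b [mod m ] = (+ m) ∣ (a ℤ.- b)

open import Data.Nat.Divisibility as ℕD using ()
open import Relation.Nullary using (¬_)

Even : ℕ → Set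
Even n = 2 ℕD.∣ n

Odd : ℕ → Set
Odd n = ¬ Even n

module Submission where

-- Lucas' theorem for Fibonomials modulo 3.  In the symmetric form G a b = C(a + b, a), both the
-- binomial and the Fibonomial array obey a weighted Pascal rule whose weights repeat with period p
-- up to a sign σ: p = 3, σ = 1 for binomials, and p = 4, σ = −1 for Fibonomials, since
-- F_{n+4} = 3 F_{n+1} + 2 F_n ≡ −F_n.  One induction splits off the lowest base-p digits,
--   G(t + s p, v + w p) ≡ σ^(t w + s v) · C(s + w, s) · G(t, v)   (mod 3),
-- and iterating it for binomials is Lucas' theorem in base 3.  Combining the two at M = 4·3^m,
-- where 3^m is odd so that only the parities of the exponents matter, gives for n, k < M
--   C(n + (c + d) M, k + c M)_F ≡ (−1)^(c n + (c + d) k) · C(c + d, c) · C(n, k)_F   (mod 3);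
-- the three congruences are the cases (c, d) = (0, 1), (0, 2) and (1, 1).

open import Defs
open import Data.Nat using (ℕ; _+_; _*_; _^_; _<_)
open import Data.Integer as ℤ using (+_)
open import Data.Product using (_×_)

open import Algebra.Bundles using (CommutativeRing)
open import Algebra.Structures using (IsCommutativeRing)
open import Data.Empty using (⊥-elim)
open import Data.Fin as Fin using (Fin; toℕ)
open import Data.Fin.Properties using (all?; _≟_; toℕ-fromℕ<; toℕ-injective; toℕ≤pred[n])
open import Data.Integer.Properties using (m-n≡m⊖n; ∣⊖∣-≤; ∣m⊖n∣≡∣n⊖m∣; neg-involutive)
open import Data.List using (_∷_; [])
open import Data.Nat as ℕ using (zero; suc; z<s; s≤s; z≤n; _∸_; _≤_; _≤?_)
open import Data.Nat.DivMod
  using (_%_; _/_; _mod_; _divMod_; result; %-distribˡ-+; %-distribˡ-*; m≡m%n+[m/n]*n; m%n<n; m*n/n≡m)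
open import Data.Nat.Divisibility using (m%n≡0⇒n∣m; n∣m⇒m%n≡0) renaming (_∣_ to _∣ℕ_)
open import Data.Nat.Properties
  using ( ≤-refl; ≤-trans; <⇒≤; ≰⇒>; <⇒≱; ≤-<-trans; <-irrefl; ≤-total; ≤-<-connex
        ; m≤m+n; m≤n+m; m<m+n; m<n+m
        ; +-identityʳ; +-assoc; +-suc; *-identityˡ; *-identityʳ; *-zeroʳ; *-suc; *-assoc; *-comm
        ; m+n∸m≡n; m+[n∸m]≡n; m≤n⇒∃[o]m+o≡n; m*n≢0; *-monoˡ-≤; +-monoˡ-<; +-cancelˡ-<; *-cancelʳ-<
        ; module ≤-Reasoning )
open import Data.Nat.Tactic.RingSolver using () renaming (solve to ℕ-solve; solve-∀ to ℕ-solve-∀)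
open import Data.Product using (_,_)
open import Data.Sum using (inj₁; inj₂)
open import Function using (_∘_)
open import Relation.Binary.PropositionalEquality
  using (_≡_; _≢_; refl; sym; trans; subst; cong; cong₂; isEquivalence; module ≡-Reasoning)
open import Relation.Nullary using (yes; no)
open import Relation.Nullary.Decidable using (True; toWitness; dec⇒maybe)
open import Relation.Unary using (Decidable)
open import Tactic.RingSolver using (solve-∀)
import Tactic.RingSolver.Core.AlmostCommutativeRing as ACR

ℤ₃ : Set
ℤ₃ = Fin 3

[_] : ℕ → ℤ₃
[ n ] = n mod 3

0₃ 1₃ : ℤ₃
0₃ = [ 0 ]
1₃ = [ 1 ]

infixl 6 _+₃_
infixl 7 _*₃_
infix 8 -₃_

-- Matching on the first argument (rather than computing through [_]) keeps terms with a variable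
-- first argument neutral, which the unifier relies on below.
_+₃_ : ℤ₃ → ℤ₃ → ℤ₃
Fin.zero                   +₃ y = y
Fin.suc Fin.zero           +₃ y = [ suc (toℕ y) ]
Fin.suc (Fin.suc Fin.zero) +₃ y = [ suc (suc (toℕ y)) ]

-₃_ : ℤ₃ → ℤ₃
-₃ x = [ 3 ∸ toℕ x ]

_*₃_ : ℤ₃ → ℤ₃ → ℤ₃
Fin.zero                   *₃ y = 0₃
Fin.suc Fin.zero           *₃ y = y
Fin.suc (Fin.suc Fin.zero) *₃ y = -₃ y

-- ℤ₃ is finite, so its ring laws are checked by evaluating both sides everywhere.
by-evaluation : {P : ℤ₃ → Set} (P? : Decidable P) → {True (all? P?)} → ∀ x → P x
by-evaluation P? {holds} = toWitness holds

+₃-*₃-isCommutativeRing : IsCommutativeRing _≡_ _+₃_ _*₃_ -₃_ 0₃ 1₃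
+₃-*₃-isCommutativeRing = record
  { isRing = record
    { +-isAbelianGroup = record
      { isGroup = record
        { isMonoid = record
          { isSemigroup = record
            { isMagma = record { isEquivalence = isEquivalence ; ∙-cong = cong₂ _+₃_ }
            ; assoc = by-evaluation λ x → all? λ y → all? λ z → x +₃ y +₃ z ≟ x +₃ (y +₃ z) }
          ; identity = by-evaluation (λ x → 0₃ +₃ x ≟ x) , by-evaluation (λ x → x +₃ 0₃ ≟ x) }
        ; inverse = by-evaluation (λ x → -₃ x +₃ x ≟ 0₃) , by-evaluation (λ x → x +₃ -₃ x ≟ 0₃)
        ; ⁻¹-cong = cong -₃_ }
      ; comm = by-evaluation λ x → all? λ y → x +₃ y ≟ y +₃ x }
    ; *-cong = cong₂ _*₃_
    ; *-assoc = by-evaluation λ x → all? λ y → all? λ z → x *₃ y *₃ z ≟ x *₃ (y *₃ z)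
    ; *-identity = by-evaluation (λ x → 1₃ *₃ x ≟ x) , by-evaluation (λ x → x *₃ 1₃ ≟ x)
    ; distrib = (by-evaluation λ x → all? λ y → all? λ z → x *₃ (y +₃ z) ≟ x *₃ y +₃ x *₃ z)
              , (by-evaluation λ x → all? λ y → all? λ z → (y +₃ z) *₃ x ≟ y *₃ x +₃ z *₃ x) }
  ; *-comm = by-evaluation λ x → all? λ y → x *₃ y ≟ y *₃ x }

+₃-*₃-commutativeRing : CommutativeRing _ _
+₃-*₃-commutativeRing = record { isCommutativeRing = +₃-*₃-isCommutativeRing }

open CommutativeRing +₃-*₃-commutativeRing
  using (semiring)
  renaming ( +-identityˡ to +₃-identityˡ; +-identityʳ to +₃-identityʳ; -‿inverseˡ to -₃-inverseˡ
           ; *-assoc to *₃-assoc; *-identityˡ to *₃-identityˡ; *-identityʳ to *₃-identityʳ )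
open import Algebra.Properties.Semiring.Exp semiring
  using () renaming (_^_ to _^₃_; ^-homo-* to ^₃-homo-*₃; ^-assocʳ to ^₃-assocʳ)
open import Algebra.Properties.Group (CommutativeRing.+-group +₃-*₃-commutativeRing)
  using () renaming (identityʳ-unique to +₃-identityʳ-unique)

+₃-*₃-almostCommutativeRing : ACR.AlmostCommutativeRing _ _
+₃-*₃-almostCommutativeRing = ACR.fromCommutativeRing +₃-*₃-commutativeRing (λ x → dec⇒maybe (0₃ ≟ x))

toℕ-[] : ∀ n → toℕ [ n ] ≡ n % 3
toℕ-[] n = toℕ-fromℕ< _

[]-homo-+ : ∀ m n → [ m + n ] ≡ [ m ] +₃ [ n ]
[]-homo-+ m n = toℕ-injective (begin
  toℕ [ m + n ]                ≡⟨ toℕ-[] (m + n) ⟩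
  (m + n) % 3                  ≡⟨ %-distribˡ-+ m n 3 ⟩
  (m % 3 + n % 3) % 3          ≡⟨ cong₂ (λ a b → (a + b) % 3) (toℕ-[] m) (toℕ-[] n) ⟨
  (toℕ [ m ] + toℕ [ n ]) % 3  ≡⟨ toℕ-+₃ [ m ] [ n ] ⟨
  toℕ ([ m ] +₃ [ n ])         ∎)
  where
  open ≡-Reasoning
  toℕ-+₃ : ∀ x y → toℕ (x +₃ y) ≡ (toℕ x + toℕ y) % 3
  toℕ-+₃ = by-evaluation λ x → all? λ y → toℕ (x +₃ y) ℕ.≟ (toℕ x + toℕ y) % 3

[]-homo-* : ∀ m n → [ m * n ] ≡ [ m ] *₃ [ n ]
[]-homo-* m n = toℕ-injective (begin
  toℕ [ m * n ]                ≡⟨ toℕ-[] (m * n) ⟩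
  (m * n) % 3                  ≡⟨ %-distribˡ-* m n 3 ⟩
  (m % 3 * (n % 3)) % 3        ≡⟨ cong₂ (λ a b → (a * b) % 3) (toℕ-[] m) (toℕ-[] n) ⟨
  (toℕ [ m ] * toℕ [ n ]) % 3  ≡⟨ toℕ-*₃ [ m ] [ n ] ⟨
  toℕ ([ m ] *₃ [ n ])         ∎)
  where
  open ≡-Reasoning
  toℕ-*₃ : ∀ x y → toℕ (x *₃ y) ≡ (toℕ x * toℕ y) % 3
  toℕ-*₃ = by-evaluation λ x → all? λ y → toℕ (x *₃ y) ℕ.≟ (toℕ x * toℕ y) % 3

1^n≡1 : ∀ n → 1₃ ^₃ n ≡ 1₃
1^n≡1 zero    = refl
1^n≡1 (suc n) = trans (cong (1₃ *₃_) (1^n≡1 n)) (*₃-identityˡ 1₃)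

*₃-absorb : ∀ a x b h g → a *₃ x *₃ (b *₃ (h *₃ g)) ≡ a *₃ b *₃ (h *₃ (x *₃ g))
*₃-absorb = solve-∀ +₃-*₃-almostCommutativeRing

*₃-factor : ∀ x h a b → x *₃ (h *₃ a) +₃ x *₃ (h *₃ b) ≡ x *₃ (h *₃ (a +₃ b))
*₃-factor = solve-∀ +₃-*₃-almostCommutativeRing

*₃-comm-1 : ∀ x y → x *₃ y ≡ y *₃ x *₃ 1₃
*₃-comm-1 = solve-∀ +₃-*₃-almostCommutativeRing

*₃-identity-outer : ∀ h → 1₃ *₃ (h *₃ 1₃) ≡ h
*₃-identity-outer = solve-∀ +₃-*₃-almostCommutativeRing

*₃-zero-middle : ∀ x g → x *₃ (0₃ *₃ g) ≡ 0₃
*₃-zero-middle = solve-∀ +₃-*₃-almostCommutativeRing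

*₃-zero-inner : ∀ x h → x *₃ (h *₃ 0₃) ≡ 0₃
*₃-zero-inner = solve-∀ +₃-*₃-almostCommutativeRing

*₃-zero-inner³ : ∀ a x h → a *₃ (x *₃ (h *₃ 0₃)) ≡ 0₃
*₃-zero-inner³ = solve-∀ +₃-*₃-almostCommutativeRing

digit-shift : ∀ b r x c P → r + x * b + c * (b * P) ≡ r + (x + c * P) * b
digit-shift = ℕ-solve-∀

high-digit-< : ∀ b M r s → r + s * b < b * M → s < M
high-digit-< b M r s r+sb<bM =
  *-cancelʳ-< b s M (≤-<-trans (m≤n+m (s * b) r) (subst (r + s * b <_) (*-comm b M) r+sb<bM))

no-low-carry⇒high-carry : ∀ b M t v s w → t + v < b → b * M ≤ (t + s * b) + (v + w * b) → M ≤ s + w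
no-low-carry⇒high-carry b M t v s w t+v<b bM≤ with M ≤? s + w
... | yes M≤s+w = M≤s+w
... | no  M≰s+w = ⊥-elim (<-irrefl refl (begin-strict
  b + (s + w) * b            ≤⟨ *-monoˡ-≤ b (≰⇒> M≰s+w) ⟩
  M * b                      ≡⟨ *-comm M b ⟩
  b * M                      ≤⟨ bM≤ ⟩
  (t + s * b) + (v + w * b)  ≡⟨ ℕ-solve (t ∷ s ∷ b ∷ v ∷ w ∷ []) ⟩
  (t + v) + (s + w) * b      <⟨ +-monoˡ-< ((s + w) * b) t+v<b ⟩
  b + (s + w) * b            ∎))
  where open ≤-Reasoning

-- binom a b = C(a + b, a): indexing by both parts of the top makes Pascal's rule subtraction-free.
binom : ℕ → ℕ → ℕ
binom zero    b       = 1
binom (suc a) zero    = 1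
binom (suc a) (suc b) = binom a (suc b) + binom (suc a) b

binom-zeroʳ : ∀ a → binom a 0 ≡ 1
binom-zeroʳ zero    = refl
binom-zeroʳ (suc a) = refl

-- A Pascal-type array G whose weights α, β repeat with period p = q + 1 up to a factor σ, and
-- which vanishes wherever adding two base-p digits carries, satisfies Lucas' theorem in base p.
module WeightedPascal
  (q : ℕ) (σ : ℤ₃) (α β : ℕ → ℤ₃) (G : ℕ → ℕ → ℤ₃)
  (σ^[1+q]≡1 : σ ^₃ suc q ≡ 1₃)
  (α-0 : α 0 ≡ 1₃) (β-q : β q ≡ σ)
  (α-shift : ∀ y → α (suc q + y) ≡ σ *₃ α y)
  (β-shift : ∀ x → β (suc q + x) ≡ σ *₃ β x)
  (G-zeroˡ : ∀ b → G 0 b ≡ 1₃)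
  (G-zeroʳ : ∀ a → G a 0 ≡ 1₃)
  (G-step : ∀ a b → G (suc a) (suc b) ≡ α (suc b) *₃ G a (suc b) +₃ β a *₃ G (suc a) b)
  (G-carry : ∀ t v → t ≤ q → v ≤ q → q < t + v → G t v ≡ 0₃)
  where

  open ≡-Reasoning

  private
    p : ℕ
    p = suc q

  periodic : (f : ℕ → ℤ₃) → (∀ y → f (p + y) ≡ σ *₃ f y) → ∀ n y → f (y + n * p) ≡ σ ^₃ n *₃ f y
  periodic f f-shift zero    y = trans (cong f (+-identityʳ y)) (sym (*₃-identityˡ (f y)))
  periodic f f-shift (suc n) y = begin
    f (y + (p + n * p))   ≡⟨ cong f (ℕ-solve (y ∷ q ∷ n ∷ [])) ⟩
    f (p + (y + n * p))   ≡⟨ f-shift (y + n * p) ⟩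
    σ *₃ f (y + n * p)    ≡⟨ cong (σ *₃_) (periodic f f-shift n y) ⟩
    σ *₃ (σ ^₃ n *₃ f y)  ≡⟨ *₃-assoc σ (σ ^₃ n) (f y) ⟨
    σ ^₃ suc n *₃ f y     ∎

  α-wrap : ∀ w → α (suc w * p) ≡ σ ^₃ suc w *₃ 1₃
  α-wrap w = trans (periodic α α-shift (suc w) 0) (cong (σ ^₃ suc w *₃_) α-0)

  β-wrap : ∀ s → β (q + s * p) ≡ σ ^₃ suc s *₃ 1₃
  β-wrap s = begin
    β (q + s * p)     ≡⟨ periodic β β-shift s q ⟩
    σ ^₃ s *₃ β q     ≡⟨ cong (σ ^₃ s *₃_) β-q ⟩
    σ ^₃ s *₃ σ       ≡⟨ *₃-comm-1 (σ ^₃ s) σ ⟩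
    σ ^₃ suc s *₃ 1₃  ∎

  absorb : ∀ k e x h g → σ ^₃ k *₃ x *₃ (σ ^₃ e *₃ (h *₃ g)) ≡ σ ^₃ (k + e) *₃ (h *₃ (x *₃ g))
  absorb k e x h g = trans (*₃-absorb (σ ^₃ k) x (σ ^₃ e) h g)
                           (cong (λ y → y *₃ (h *₃ (x *₃ g))) (sym (^₃-homo-*₃ σ k e)))

  full-period : ∀ n k {e} h {g} → k + e ≡ p * n → g ≡ 1₃ → σ ^₃ k *₃ 1₃ *₃ (σ ^₃ e *₃ (h *₃ g)) ≡ h
  full-period n k {e} h {g} k+e≡p*n g≡1 = begin
    σ ^₃ k *₃ 1₃ *₃ (σ ^₃ e *₃ (h *₃ g))  ≡⟨ absorb k e 1₃ h g ⟩
    σ ^₃ (k + e) *₃ (h *₃ (1₃ *₃ g))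
      ≡⟨ cong₂ (λ k+e g → σ ^₃ k+e *₃ (h *₃ (1₃ *₃ g))) k+e≡p*n g≡1 ⟩
    σ ^₃ (p * n) *₃ (h *₃ 1₃)             ≡⟨ cong (λ y → y *₃ (h *₃ 1₃)) σ^[p*n]≡1 ⟩
    1₃ *₃ (h *₃ 1₃)                       ≡⟨ *₃-identity-outer h ⟩
    h                                     ∎
    where
    σ^[p*n]≡1 : σ ^₃ (p * n) ≡ 1₃
    σ^[p*n]≡1 = trans (sym (^₃-assocʳ σ p n)) (trans (cong (_^₃ n) σ^[1+q]≡1) (1^n≡1 n))

  LucasFormula : ℕ → ℕ → ℕ → ℕ → Set
  LucasFormula s t w v = G (t + s * p) (v + w * p) ≡ σ ^₃ (t * w + s * v) *₃ ([ binom s w ] *₃ G t v)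

  lucas-base : ∀ w v → LucasFormula 0 0 w v
  lucas-base w v = trans (G-zeroˡ _) (sym (cong (λ g → 1₃ *₃ (1₃ *₃ g)) (G-zeroˡ v)))

  lucas-zeroʳ : ∀ s t → LucasFormula s t 0 0
  lucas-zeroʳ s t rewrite *-zeroʳ t | *-zeroʳ s | binom-zeroʳ s | G-zeroʳ t | G-zeroʳ (t + s * p) = refl

  -- Both lowest digits wrap around: the two terms pick up σ^(p(w+1)) and σ^(p(s+1)), that is 1,
  -- and Pascal's rule for binom takes over.
  lucas-wrap-both : ∀ s w → LucasFormula s q (suc w) 0 → LucasFormula (suc s) 0 w q →
                    LucasFormula (suc s) 0 (suc w) 0
  lucas-wrap-both s w ih₁ ih₂ = begin
    G (suc (q + s * p)) (suc (q + w * p))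
      ≡⟨ G-step _ _ ⟩
    α (suc w * p) *₃ G (q + s * p) (suc w * p) +₃ β (q + s * p) *₃ G (suc s * p) (q + w * p)
      ≡⟨ cong₂ _+₃_ (cong₂ _*₃_ (α-wrap w) ih₁) (cong₂ _*₃_ (β-wrap s) ih₂) ⟩
    σ ^₃ suc w *₃ 1₃ *₃ (σ ^₃ (q * suc w + s * 0) *₃ ([ binom s (suc w) ] *₃ G q 0))
      +₃ σ ^₃ suc s *₃ 1₃ *₃ (σ ^₃ (suc s * q) *₃ ([ binom (suc s) w ] *₃ G 0 q))
      ≡⟨ cong₂ _+₃_ (full-period (suc w) (suc w) [ binom s (suc w) ] period₁ (G-zeroʳ q))
                    (full-period (suc s) (suc s) [ binom (suc s) w ] period₂ (G-zeroˡ q)) ⟩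
    [ binom s (suc w) ] +₃ [ binom (suc s) w ]
      ≡⟨ []-homo-+ (binom s (suc w)) (binom (suc s) w) ⟨
    [ binom (suc s) (suc w) ]
      ≡⟨ *₃-identity-outer [ binom (suc s) (suc w) ] ⟨
    1₃ *₃ ([ binom (suc s) (suc w) ] *₃ 1₃)
      ≡⟨ cong₂ (λ e g → σ ^₃ e *₃ ([ binom (suc s) (suc w) ] *₃ g)) (*-zeroʳ (suc s)) (G-zeroˡ 0) ⟨
    σ ^₃ (suc s * 0) *₃ ([ binom (suc s) (suc w) ] *₃ G 0 0) ∎
    where
    period₁ : suc w + (q * suc w + s * 0) ≡ suc q * suc w
    period₁ = ℕ-solve (w ∷ q ∷ s ∷ [])
    period₂ : suc s + suc s * q ≡ suc q * suc s
    period₂ = ℕ-solve (s ∷ q ∷ [])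

  lucas-wrapˡ : ∀ s w v → v < q → LucasFormula s q w (suc v) → LucasFormula (suc s) 0 w v →
                LucasFormula (suc s) 0 w (suc v)
  lucas-wrapˡ s w v v<q ih₁ ih₂ = begin
    G (suc (q + s * p)) (suc (v + w * p))
      ≡⟨ G-step _ _ ⟩
    α (suc v + w * p) *₃ G (q + s * p) (suc v + w * p) +₃ β (q + s * p) *₃ G (suc s * p) (v + w * p)
      ≡⟨ cong₂ _+₃_ (cong (α (suc v + w * p) *₃_) ih₁) (cong₂ _*₃_ (β-wrap s) ih₂) ⟩
    α (suc v + w * p) *₃ (σ ^₃ (q * w + s * suc v) *₃ ([ binom s w ] *₃ G q (suc v)))
      +₃ σ ^₃ suc s *₃ 1₃ *₃ (σ ^₃ (suc s * v) *₃ ([ binom (suc s) w ] *₃ G 0 v))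
      ≡⟨ cong₂ _+₃_ (cong (λ g → α (suc v + w * p) *₃ (σ ^₃ (q * w + s * suc v) *₃ ([ binom s w ] *₃ g)))
                          (G-carry q (suc v) ≤-refl v<q (m<m+n q z<s)))
                    (absorb (suc s) (suc s * v) 1₃ [ binom (suc s) w ] (G 0 v)) ⟩
    α (suc v + w * p) *₃ (σ ^₃ (q * w + s * suc v) *₃ ([ binom s w ] *₃ 0₃))
      +₃ σ ^₃ (suc s + suc s * v) *₃ ([ binom (suc s) w ] *₃ (1₃ *₃ G 0 v))
      ≡⟨ cong₂ _+₃_ (*₃-zero-inner³ (α (suc v + w * p)) (σ ^₃ (q * w + s * suc v)) [ binom s w ])
                    (cong₂ (λ e g → σ ^₃ e *₃ ([ binom (suc s) w ] *₃ g)) (sym (*-suc (suc s) v))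
                           (trans (*₃-identityˡ (G 0 v)) (trans (G-zeroˡ v) (sym (G-zeroˡ (suc v)))))) ⟩
    0₃ +₃ σ ^₃ (suc s * suc v) *₃ ([ binom (suc s) w ] *₃ G 0 (suc v))
      ≡⟨ +₃-identityˡ _ ⟩
    σ ^₃ (suc s * suc v) *₃ ([ binom (suc s) w ] *₃ G 0 (suc v)) ∎

  lucas-wrapʳ : ∀ s t w → t < q → LucasFormula s t (suc w) 0 → LucasFormula s (suc t) w q →
                LucasFormula s (suc t) (suc w) 0
  lucas-wrapʳ s t w t<q ih₁ ih₂ = begin
    G (suc (t + s * p)) (suc (q + w * p))
      ≡⟨ G-step _ _ ⟩
    α (suc w * p) *₃ G (t + s * p) (suc w * p) +₃ β (t + s * p) *₃ G (suc t + s * p) (q + w * p)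
      ≡⟨ cong₂ _+₃_ (cong₂ _*₃_ (α-wrap w) ih₁) (cong (β (t + s * p) *₃_) ih₂) ⟩
    σ ^₃ suc w *₃ 1₃ *₃ (σ ^₃ (t * suc w + s * 0) *₃ ([ binom s (suc w) ] *₃ G t 0))
      +₃ β (t + s * p) *₃ (σ ^₃ (suc t * w + s * q) *₃ ([ binom s w ] *₃ G (suc t) q))
      ≡⟨ cong₂ _+₃_ (absorb (suc w) (t * suc w + s * 0) 1₃ [ binom s (suc w) ] (G t 0))
                    (cong (λ g → β (t + s * p) *₃ (σ ^₃ (suc t * w + s * q) *₃ ([ binom s w ] *₃ g)))
                          (G-carry (suc t) q t<q ≤-refl (m<n+m q z<s))) ⟩
    σ ^₃ (suc w + (t * suc w + s * 0)) *₃ ([ binom s (suc w) ] *₃ (1₃ *₃ G t 0))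
      +₃ β (t + s * p) *₃ (σ ^₃ (suc t * w + s * q) *₃ ([ binom s w ] *₃ 0₃))
      ≡⟨ cong₂ _+₃_ (cong₂ (λ e g → σ ^₃ e *₃ ([ binom s (suc w) ] *₃ g))
                           (sym (+-assoc (suc w) (t * suc w) (s * 0)))
                           (trans (*₃-identityˡ (G t 0)) (trans (G-zeroʳ t) (sym (G-zeroʳ (suc t))))))
                    (*₃-zero-inner³ (β (t + s * p)) (σ ^₃ (suc t * w + s * q)) [ binom s w ]) ⟩
    σ ^₃ (suc t * suc w + s * 0) *₃ ([ binom s (suc w) ] *₃ G (suc t) 0) +₃ 0₃
      ≡⟨ +₃-identityʳ _ ⟩
    σ ^₃ (suc t * suc w + s * 0) *₃ ([ binom s (suc w) ] *₃ G (suc t) 0) ∎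

  lucas-step : ∀ s t w v → LucasFormula s t w (suc v) → LucasFormula s (suc t) w v →
               LucasFormula s (suc t) w (suc v)
  lucas-step s t w v ih₁ ih₂ = begin
    G (suc (t + s * p)) (suc (v + w * p))
      ≡⟨ G-step _ _ ⟩
    α (suc v + w * p) *₃ G (t + s * p) (suc v + w * p) +₃ β (t + s * p) *₃ G (suc t + s * p) (v + w * p)
      ≡⟨ cong₂ _+₃_ (cong₂ _*₃_ (periodic α α-shift w (suc v)) ih₁)
                    (cong₂ _*₃_ (periodic β β-shift s t) ih₂) ⟩
    σ ^₃ w *₃ α (suc v) *₃ (σ ^₃ (t * w + s * suc v) *₃ (H *₃ G t (suc v)))
      +₃ σ ^₃ s *₃ β t *₃ (σ ^₃ (suc t * w + s * v) *₃ (H *₃ G (suc t) v))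
      ≡⟨ cong₂ _+₃_ (absorb w (t * w + s * suc v) (α (suc v)) H (G t (suc v)))
                    (absorb s (suc t * w + s * v) (β t) H (G (suc t) v)) ⟩
    σ ^₃ (w + (t * w + s * suc v)) *₃ (H *₃ (α (suc v) *₃ G t (suc v)))
      +₃ σ ^₃ (s + (suc t * w + s * v)) *₃ (H *₃ (β t *₃ G (suc t) v))
      ≡⟨ cong₂ (λ e e′ → σ ^₃ e *₃ (H *₃ (α (suc v) *₃ G t (suc v)))
                         +₃ σ ^₃ e′ *₃ (H *₃ (β t *₃ G (suc t) v)))
               exponent₁ exponent₂ ⟩
    σ ^₃ E *₃ (H *₃ (α (suc v) *₃ G t (suc v))) +₃ σ ^₃ E *₃ (H *₃ (β t *₃ G (suc t) v))
      ≡⟨ *₃-factor (σ ^₃ E) H (α (suc v) *₃ G t (suc v)) (β t *₃ G (suc t) v) ⟩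
    σ ^₃ E *₃ (H *₃ (α (suc v) *₃ G t (suc v) +₃ β t *₃ G (suc t) v))
      ≡⟨ cong (λ g → σ ^₃ E *₃ (H *₃ g)) (G-step t v) ⟨
    σ ^₃ E *₃ (H *₃ G (suc t) (suc v)) ∎
    where
    H : ℤ₃
    H = [ binom s w ]
    E : ℕ
    E = suc t * w + s * suc v
    exponent₁ : w + (t * w + s * suc v) ≡ suc t * w + s * suc v
    exponent₁ = ℕ-solve (w ∷ t ∷ s ∷ v ∷ [])
    exponent₂ : s + (suc t * w + s * v) ≡ suc t * w + s * suc v
    exponent₂ = ℕ-solve (w ∷ t ∷ s ∷ v ∷ [])

  lucas : ∀ s t w v → t ≤ q → v ≤ q → LucasFormula s t w v
  lucas zero    zero    w       v       _   _   = lucas-base w v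
  lucas s       t       zero    zero    _   _   = lucas-zeroʳ s t
  lucas (suc s) zero    (suc w) zero    _   _   =
    lucas-wrap-both s w (lucas s q (suc w) 0 ≤-refl z≤n) (lucas (suc s) 0 w q z≤n ≤-refl)
  lucas (suc s) zero    w       (suc v) _   v<q =
    lucas-wrapˡ s w v v<q (lucas s q w (suc v) ≤-refl v<q) (lucas (suc s) 0 w v z≤n (<⇒≤ v<q))
  lucas s       (suc t) (suc w) zero    t<q _   =
    lucas-wrapʳ s t w t<q (lucas s t (suc w) 0 (<⇒≤ t<q) z≤n) (lucas s (suc t) w q t<q ≤-refl)
  lucas s       (suc t) w       (suc v) t<q v<q =
    lucas-step s t w v (lucas s t w (suc v) (<⇒≤ t<q) v<q) (lucas s (suc t) w v t<q (<⇒≤ v<q))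

  lucas-vanishes : ∀ s t w v → t ≤ q → v ≤ q → (t + v ≤ q → [ binom s w ] ≡ 0₃) →
                   G (t + s * p) (v + w * p) ≡ 0₃
  lucas-vanishes s t w v t≤q v≤q binom≡0 with t + v ≤? q
  ... | yes t+v≤q = trans (lucas s t w v t≤q v≤q)
                          (trans (cong (λ h → σ ^₃ (t * w + s * v) *₃ (h *₃ G t v)) (binom≡0 t+v≤q))
                                 (*₃-zero-middle (σ ^₃ (t * w + s * v)) (G t v)))
  ... | no  t+v≰q = trans (lucas s t w v t≤q v≤q)
                          (trans (cong (λ g → σ ^₃ (t * w + s * v) *₃ ([ binom s w ] *₃ g))
                                       (G-carry t v t≤q v≤q (≰⇒> t+v≰q)))
                                 (*₃-zero-inner (σ ^₃ (t * w + s * v)) [ binom s w ]))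

binom-small-carry : ∀ t v → t ≤ 2 → v ≤ 2 → 2 < t + v → [ binom t v ] ≡ 0₃
binom-small-carry 1 2 _ _ _ = refl
binom-small-carry 2 1 _ _ _ = refl
binom-small-carry 2 2 _ _ _ = refl
binom-small-carry 0 0 _ _ ()
binom-small-carry 0 1 _ _ (s≤s ())
binom-small-carry 0 2 _ _ (s≤s (s≤s ()))
binom-small-carry 1 0 _ _ (s≤s ())
binom-small-carry 1 1 _ _ (s≤s (s≤s ()))
binom-small-carry 2 0 _ _ (s≤s (s≤s ()))
binom-small-carry (suc (suc (suc _))) _ (s≤s (s≤s ())) _ _
binom-small-carry _ (suc (suc (suc _))) _ (s≤s (s≤s ())) _

module BinomialLucas = WeightedPascal 2 1₃ (λ _ → 1₃) (λ _ → 1₃) (λ a b → [ binom a b ])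
  refl refl refl (λ _ → refl) (λ _ → refl) (λ _ → refl) (λ a → cong [_] (binom-zeroʳ a))
  (λ a b → []-homo-+ (binom a (suc b)) (binom (suc a) b)) binom-small-carry

binom-lucas-digit : ∀ s t w v → t ≤ 2 → v ≤ 2 →
                    [ binom (t + s * 3) (v + w * 3) ] ≡ [ binom s w ] *₃ [ binom t v ]
binom-lucas-digit s t w v t≤2 v≤2 =
  trans (BinomialLucas.lucas s t w v t≤2 v≤2)
        (trans (cong (_*₃ ([ binom s w ] *₃ [ binom t v ])) (1^n≡1 (t * w + s * v)))
               (*₃-identityˡ ([ binom s w ] *₃ [ binom t v ])))

binom-lucas : ∀ m {s w} c d → s < 3 ^ m → w < 3 ^ m →
              [ binom (s + c * 3 ^ m) (w + d * 3 ^ m) ] ≡ [ binom c d ] *₃ [ binom s w ]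
binom-lucas zero {zero} {zero} c d _ _ =
  trans (cong₂ (λ x y → [ binom x y ]) (*-identityʳ c) (*-identityʳ d)) (sym (*₃-identityʳ [ binom c d ]))
binom-lucas zero {suc _}     _ _ (s≤s ()) _
binom-lucas zero {w = suc _} _ _ _        (s≤s ())
binom-lucas (suc m) {s} {w} c d s< w< with s divMod 3 | w divMod 3
... | result s′ t refl | result w′ v refl = begin
  [ binom (toℕ t + s′ * 3 + c * 3 ^ suc m) (toℕ v + w′ * 3 + d * 3 ^ suc m) ]
    ≡⟨ cong₂ (λ x y → [ binom x y ]) (digit-shift 3 (toℕ t) s′ c (3 ^ m)) (digit-shift 3 (toℕ v) w′ d (3 ^ m)) ⟩
  [ binom (toℕ t + (s′ + c * 3 ^ m) * 3) (toℕ v + (w′ + d * 3 ^ m) * 3) ]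
    ≡⟨ binom-lucas-digit (s′ + c * 3 ^ m) (toℕ t) (w′ + d * 3 ^ m) (toℕ v) (toℕ≤pred[n] t) (toℕ≤pred[n] v) ⟩
  [ binom (s′ + c * 3 ^ m) (w′ + d * 3 ^ m) ] *₃ [ binom (toℕ t) (toℕ v) ]
    ≡⟨ cong (_*₃ [ binom (toℕ t) (toℕ v) ])
            (binom-lucas m c d (high-digit-< 3 (3 ^ m) (toℕ t) s′ s<) (high-digit-< 3 (3 ^ m) (toℕ v) w′ w<)) ⟩
  [ binom c d ] *₃ [ binom s′ w′ ] *₃ [ binom (toℕ t) (toℕ v) ]
    ≡⟨ *₃-assoc [ binom c d ] [ binom s′ w′ ] [ binom (toℕ t) (toℕ v) ] ⟩
  [ binom c d ] *₃ ([ binom s′ w′ ] *₃ [ binom (toℕ t) (toℕ v) ])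
    ≡⟨ cong ([ binom c d ] *₃_) (binom-lucas-digit s′ (toℕ t) w′ (toℕ v) (toℕ≤pred[n] t) (toℕ≤pred[n] v)) ⟨
  [ binom c d ] *₃ [ binom (toℕ t + s′ * 3) (toℕ v + w′ * 3) ] ∎
  where open ≡-Reasoning

binom-carry : ∀ m {s w} → s < 3 ^ m → w < 3 ^ m → 3 ^ m ≤ s + w → [ binom s w ] ≡ 0₃
binom-carry zero {zero}  {zero}  _        _        ()
binom-carry zero {suc _} {_}     (s≤s ()) _        _
binom-carry zero {_}     {suc _} _        (s≤s ()) _
binom-carry (suc m) {s} {w} s< w< carry with s divMod 3 | w divMod 3
... | result s′ t refl | result w′ v refl =
  BinomialLucas.lucas-vanishes s′ (toℕ t) w′ (toℕ v) (toℕ≤pred[n] t) (toℕ≤pred[n] v) λ t+v≤2 →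
    binom-carry m (high-digit-< 3 (3 ^ m) (toℕ t) s′ s<) (high-digit-< 3 (3 ^ m) (toℕ v) w′ w<)
      (no-low-carry⇒high-carry 3 (3 ^ m) (toℕ t) (toℕ v) s′ w′ (s≤s t+v≤2) carry)

-1₃ : ℤ₃
-1₃ = -₃ 1₃

-1^-+2* : ∀ x y → -1₃ ^₃ (x + 2 * y) ≡ -1₃ ^₃ x
-1^-+2* x y = begin
  -1₃ ^₃ (x + 2 * y)          ≡⟨ ^₃-homo-*₃ -1₃ x (2 * y) ⟩
  -1₃ ^₃ x *₃ -1₃ ^₃ (2 * y)  ≡⟨ cong (-1₃ ^₃ x *₃_) (trans (sym (^₃-assocʳ -1₃ 2 y)) (1^n≡1 y)) ⟩
  -1₃ ^₃ x *₃ 1₃              ≡⟨ *₃-identityʳ (-1₃ ^₃ x) ⟩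
  -1₃ ^₃ x                    ∎
  where open ≡-Reasoning

-1^-mod-2 : ∀ k → -1₃ ^₃ k ≡ -1₃ ^₃ (k % 2)
-1^-mod-2 k = begin
  -1₃ ^₃ k
    ≡⟨ cong (-1₃ ^₃_) (trans (m≡m%n+[m/n]*n k 2) (cong (λ x → k % 2 + x) (*-comm (k / 2) 2))) ⟩
  -1₃ ^₃ (k % 2 + 2 * (k / 2))
    ≡⟨ -1^-+2* (k % 2) (k / 2) ⟩
  -1₃ ^₃ (k % 2) ∎
  where open ≡-Reasoning

-1^even : ∀ {k} → Even k → -1₃ ^₃ k ≡ 1₃
-1^even {k} k-even = trans (-1^-mod-2 k) (cong (-1₃ ^₃_) (n∣m⇒m%n≡0 k 2 k-even))

-1^odd : ∀ {k} → Odd k → -1₃ ^₃ k ≡ -1₃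
-1^odd {k} k-odd = trans (-1^-mod-2 k) (cong (-1₃ ^₃_) (bit≢0 (k % 2) (m%n<n k 2) (k-odd ∘ m%n≡0⇒n∣m k 2)))
  where
  bit≢0 : ∀ r → r < 2 → r ≢ 0 → r ≡ 1
  bit≢0 0 _ r≢0 = ⊥-elim (r≢0 refl)
  bit≢0 1 _ _   = refl
  bit≢0 (suc (suc _)) (s≤s (s≤s ())) _

-1^-3^m* : ∀ m y → -1₃ ^₃ (3 ^ m * y) ≡ -1₃ ^₃ y
-1^-3^m* m y = trans (sym (^₃-assocʳ -1₃ (3 ^ m) y)) (cong (_^₃ y) (-1^3^m m))
  where
  -1^3^m : ∀ m → -1₃ ^₃ 3 ^ m ≡ -1₃
  -1^3^m zero    = refl
  -1^3^m (suc m) = trans (sym (^₃-assocʳ -1₃ 3 (3 ^ m))) (-1^3^m m)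

-1^-lucas : ∀ m t s v w c d →
  -1₃ ^₃ (t * (w + d * 3 ^ m) + (s + c * 3 ^ m) * v)
    ≡ -1₃ ^₃ (t * w + s * v) *₃ -1₃ ^₃ ((t + s * 4) * d + c * (v + w * 4))
-1^-lucas m t s v w c d = begin
  -1₃ ^₃ (t * (w + d * N) + (s + c * N) * v)
    ≡⟨ cong (-1₃ ^₃_) (split₁ t s v w c d N) ⟩
  -1₃ ^₃ (t * w + s * v + N * (t * d + c * v))
    ≡⟨ ^₃-homo-*₃ -1₃ (t * w + s * v) (N * (t * d + c * v)) ⟩
  -1₃ ^₃ (t * w + s * v) *₃ -1₃ ^₃ (N * (t * d + c * v))
    ≡⟨ cong (-1₃ ^₃ (t * w + s * v) *₃_) (-1^-3^m* m (t * d + c * v)) ⟩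
  -1₃ ^₃ (t * w + s * v) *₃ -1₃ ^₃ (t * d + c * v)
    ≡⟨ cong (-1₃ ^₃ (t * w + s * v) *₃_) (-1^-+2* (t * d + c * v) (2 * (s * d + c * w))) ⟨
  -1₃ ^₃ (t * w + s * v) *₃ -1₃ ^₃ (t * d + c * v + 2 * (2 * (s * d + c * w)))
    ≡⟨ cong (λ e → -1₃ ^₃ (t * w + s * v) *₃ -1₃ ^₃ e) (split₂ t s v w c d) ⟩
  -1₃ ^₃ (t * w + s * v) *₃ -1₃ ^₃ ((t + s * 4) * d + c * (v + w * 4)) ∎
  where
  open ≡-Reasoning
  N : ℕ
  N = 3 ^ m
  split₁ : ∀ t s v w c d N → t * (w + d * N) + (s + c * N) * v ≡ t * w + s * v + N * (t * d + c * v)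
  split₁ = ℕ-solve-∀
  split₂ : ∀ t s v w c d → t * d + c * v + 2 * (2 * (s * d + c * w)) ≡ (t + s * 4) * d + c * (v + w * 4)
  split₂ = ℕ-solve-∀

fib-+4 : ∀ n → [ fib (4 + n) ] ≡ -1₃ *₃ [ fib n ]
fib-+4 n = begin
  [ fib (4 + n) ]                                 ≡⟨ cong [_] (expand (fib (suc n)) (fib n)) ⟩
  [ 3 * fib (suc n) + 2 * fib n ]                 ≡⟨ []-homo-+ (3 * fib (suc n)) (2 * fib n) ⟩
  [ 3 * fib (suc n) ] +₃ [ 2 * fib n ]            ≡⟨ cong₂ _+₃_ ([]-homo-* 3 (fib (suc n))) ([]-homo-* 2 (fib n)) ⟩
  [ 3 ] *₃ [ fib (suc n) ] +₃ [ 2 ] *₃ [ fib n ]  ≡⟨ reduce [ fib (suc n) ] [ fib n ] ⟩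
  -1₃ *₃ [ fib n ]                                ∎
  where
  open ≡-Reasoning
  expand : ∀ a b → a + b + a + (a + b) ≡ 3 * a + 2 * b
  expand = ℕ-solve-∀
  reduce : ∀ x y → [ 3 ] *₃ x +₃ [ 2 ] *₃ y ≡ -1₃ *₃ y
  reduce = solve-∀ +₃-*₃-almostCommutativeRing

fib-+ : ∀ m n → fib (suc (m + n)) ≡ fib (suc m) * fib (suc n) + fib m * fib n
fib-+ zero    n = sym (trans (+-identityʳ (1 * fib (suc n))) (*-identityˡ (fib (suc n))))
fib-+ (suc m) n = begin
  fib (suc (suc m + n))                                  ≡⟨ cong (fib ∘ suc) (+-suc m n) ⟨
  fib (suc (m + suc n))                                  ≡⟨ fib-+ m (suc n) ⟩
  fib (suc m) * fib (suc (suc n)) + fib m * fib (suc n)  ≡⟨ regroup (fib (suc m)) (fib m) (fib (suc n)) (fib n) ⟩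
  fib (suc (suc m)) * fib (suc n) + fib (suc m) * fib n  ∎
  where
  open ≡-Reasoning
  regroup : ∀ a b c d → a * (c + d) + b * c ≡ (a + b) * c + a * d
  regroup = ℕ-solve-∀

-- fibonom a b = C(a + b, a)_F, generated by the Fibonomial analogue of Pascal's rule.
fibonom : ℕ → ℕ → ℕ
fibonom zero    b       = 1
fibonom (suc a) zero    = 1
fibonom (suc a) (suc b) = fib (suc (suc b)) * fibonom a (suc b) + fib a * fibonom (suc a) b

fibonom-zeroʳ : ∀ a → fibonom a 0 ≡ 1
fibonom-zeroʳ zero    = refl
fibonom-zeroʳ (suc a) = refl

-- Each of these Fibonomials has the factor F_4 = 3 in its numerator.
fibonom-small-carry : ∀ t v → t ≤ 3 → v ≤ 3 → 3 < t + v → [ fibonom t v ] ≡ 0₃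
fibonom-small-carry 1 3 _ _ _ = refl
fibonom-small-carry 2 2 _ _ _ = refl
fibonom-small-carry 2 3 _ _ _ = refl
fibonom-small-carry 3 1 _ _ _ = refl
fibonom-small-carry 3 2 _ _ _ = refl
fibonom-small-carry 3 3 _ _ _ = refl
fibonom-small-carry 0 0 _ _ ()
fibonom-small-carry 0 1 _ _ (s≤s ())
fibonom-small-carry 0 2 _ _ (s≤s (s≤s ()))
fibonom-small-carry 0 3 _ _ (s≤s (s≤s (s≤s ())))
fibonom-small-carry 1 0 _ _ (s≤s ())
fibonom-small-carry 1 1 _ _ (s≤s (s≤s ()))
fibonom-small-carry 1 2 _ _ (s≤s (s≤s (s≤s ())))
fibonom-small-carry 2 0 _ _ (s≤s (s≤s ()))
fibonom-small-carry 2 1 _ _ (s≤s (s≤s (s≤s ())))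
fibonom-small-carry 3 0 _ _ (s≤s (s≤s (s≤s ())))
fibonom-small-carry (suc (suc (suc (suc _)))) _ (s≤s (s≤s (s≤s ()))) _ _
fibonom-small-carry _ (suc (suc (suc (suc _)))) _ (s≤s (s≤s (s≤s ()))) _

module FibonomialLucas =
  WeightedPascal 3 -1₃ (λ y → [ fib (suc y) ]) (λ x → [ fib x ]) (λ a b → [ fibonom a b ])
    refl refl refl (λ y → fib-+4 (suc y)) fib-+4 (λ _ → refl) (λ a → cong [_] (fibonom-zeroʳ a))
    (λ a b → trans ([]-homo-+ (fib (suc (suc b)) * fibonom a (suc b)) (fib a * fibonom (suc a) b))
                   (cong₂ _+₃_ ([]-homo-* (fib (suc (suc b))) (fibonom a (suc b)))
                               ([]-homo-* (fib a) (fibonom (suc a) b))))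
    fibonom-small-carry

fibonom-lucas : ∀ m {a b} c d → a < 4 * 3 ^ m → b < 4 * 3 ^ m →
  [ fibonom (a + c * (4 * 3 ^ m)) (b + d * (4 * 3 ^ m)) ] ≡ -1₃ ^₃ (a * d + c * b) *₃ ([ binom c d ] *₃ [ fibonom a b ])
fibonom-lucas m {a} {b} c d a< b< with a divMod 4 | b divMod 4
... | result s t refl | result w v refl = begin
  [ fibonom (toℕ t + s * 4 + c * (4 * N)) (toℕ v + w * 4 + d * (4 * N)) ]
    ≡⟨ cong₂ (λ x y → [ fibonom x y ]) (digit-shift 4 (toℕ t) s c N) (digit-shift 4 (toℕ v) w d N) ⟩
  [ fibonom (toℕ t + (s + c * N) * 4) (toℕ v + (w + d * N) * 4) ]
    ≡⟨ FibonomialLucas.lucas (s + c * N) (toℕ t) (w + d * N) (toℕ v) (toℕ≤pred[n] t) (toℕ≤pred[n] v) ⟩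
  -1₃ ^₃ (toℕ t * (w + d * N) + (s + c * N) * toℕ v) *₃ ([ binom (s + c * N) (w + d * N) ] *₃ F)
    ≡⟨ cong₂ (λ x h → x *₃ (h *₃ F)) (-1^-lucas m (toℕ t) s (toℕ v) w c d)
             (binom-lucas m c d (high-digit-< 4 N (toℕ t) s a<) (high-digit-< 4 N (toℕ v) w b<)) ⟩
  -1₃ ^₃ (toℕ t * w + s * toℕ v) *₃ -1₃ ^₃ (a′ * d + c * b′) *₃ ([ binom c d ] *₃ [ binom s w ] *₃ F)
    ≡⟨ regroup (-1₃ ^₃ (toℕ t * w + s * toℕ v)) (-1₃ ^₃ (a′ * d + c * b′)) [ binom c d ] [ binom s w ] F ⟩
  -1₃ ^₃ (a′ * d + c * b′) *₃ ([ binom c d ] *₃ (-1₃ ^₃ (toℕ t * w + s * toℕ v) *₃ ([ binom s w ] *₃ F)))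
    ≡⟨ cong (λ x → -1₃ ^₃ (a′ * d + c * b′) *₃ ([ binom c d ] *₃ x))
            (FibonomialLucas.lucas s (toℕ t) w (toℕ v) (toℕ≤pred[n] t) (toℕ≤pred[n] v)) ⟨
  -1₃ ^₃ (a′ * d + c * b′) *₃ ([ binom c d ] *₃ [ fibonom a′ b′ ]) ∎
  where
  open ≡-Reasoning
  N a′ b′ : ℕ
  N = 3 ^ m
  a′ = toℕ t + s * 4
  b′ = toℕ v + w * 4
  F : ℤ₃
  F = [ fibonom (toℕ t) (toℕ v) ]
  regroup : ∀ x y C H F → x *₃ y *₃ (C *₃ H *₃ F) ≡ y *₃ (C *₃ (x *₃ (H *₃ F)))
  regroup = solve-∀ +₃-*₃-almostCommutativeRing

fibonom-carry : ∀ m {a b} → a < 4 * 3 ^ m → b < 4 * 3 ^ m → 4 * 3 ^ m ≤ a + b → [ fibonom a b ] ≡ 0₃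
fibonom-carry m {a} {b} a< b< carry with a divMod 4 | b divMod 4
... | result s t refl | result w v refl =
  FibonomialLucas.lucas-vanishes s (toℕ t) w (toℕ v) (toℕ≤pred[n] t) (toℕ≤pred[n] v) λ t+v≤3 →
    binom-carry m (high-digit-< 4 (3 ^ m) (toℕ t) s a<) (high-digit-< 4 (3 ^ m) (toℕ v) w b<)
      (no-low-carry⇒high-carry 4 (3 ^ m) (toℕ t) (toℕ v) s w (s≤s t+v≤3) carry)

fibonom-fibFact : ∀ a b → fibonom a b * fibFact a * fibFact b ≡ fibFact (a + b)
fibonom-fibFact zero    b    = +-identityʳ (fibFact b)
fibonom-fibFact (suc a) zero =
  trans (*-identityʳ (1 * fibFact (suc a)))
        (trans (*-identityˡ (fibFact (suc a))) (cong fibFact (sym (+-identityʳ (suc a)))))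
fibonom-fibFact (suc a) (suc b) = begin
  (Fb₂ * D₁ + Fa * D₂) * (Fa₁ * a!) * (Fb₁ * b!)
    ≡⟨ regroup Fb₂ D₁ Fa D₂ Fa₁ a! Fb₁ b! ⟩
  Fb₂ * Fa₁ * (D₁ * a! * (Fb₁ * b!)) + Fa * Fb₁ * (D₂ * (Fa₁ * a!) * b!)
    ≡⟨ cong₂ (λ x y → Fb₂ * Fa₁ * x + Fa * Fb₁ * y)
             (fibonom-fibFact a (suc b)) (trans (fibonom-fibFact (suc a) b) (cong fibFact (sym (+-suc a b)))) ⟩
  Fb₂ * Fa₁ * fibFact (a + suc b) + Fa * Fb₁ * fibFact (a + suc b)
    ≡⟨ collect Fb₂ Fa₁ Fa Fb₁ (fibFact (a + suc b)) ⟩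
  (Fa₁ * Fb₂ + Fa * Fb₁) * fibFact (a + suc b)
    ≡⟨ cong (_* fibFact (a + suc b)) (fib-+ a (suc b)) ⟨
  fibFact (suc a + suc b) ∎
  where
  open ≡-Reasoning
  Fa Fa₁ Fb₁ Fb₂ D₁ D₂ a! b! : ℕ
  Fa = fib a
  Fa₁ = fib (suc a)
  Fb₁ = fib (suc b)
  Fb₂ = fib (suc (suc b))
  D₁ = fibonom a (suc b)
  D₂ = fibonom (suc a) b
  a! = fibFact a
  b! = fibFact b
  regroup : ∀ x d₁ y d₂ u f v g →
    (x * d₁ + y * d₂) * (u * f) * (v * g) ≡ x * u * (d₁ * f * (v * g)) + y * v * (d₂ * (u * f) * g)
  regroup = ℕ-solve-∀
  collect : ∀ x u y v X → x * u * X + y * v * X ≡ (u * x + y * v) * X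
  collect = ℕ-solve-∀

fibonomial-fibonom : ∀ a b → fibonomial (a + b) a ≡ fibonom a b
fibonomial-fibonom a b with a ≤? a + b
... | no  a≰a+b = ⊥-elim (a≰a+b (m≤m+n a b))
... | yes _ rewrite m+n∸m≡n a b | sym (fibonom-fibFact a b) | *-assoc (fibonom a b) (fibFact a) (fibFact b) =
  m*n/n≡m (fibonom a b) (fibFact a * fibFact b) {{m*n≢0 (fibFact a) (fibFact b) {{fibFact-nz a}} {{fibFact-nz b}}}}

fibonomial-> : ∀ {n k} → n < k → fibonomial n k ≡ 0
fibonomial-> {n} {k} n<k with k ≤? n
... | yes k≤n = ⊥-elim (<⇒≱ n<k k≤n)
... | no  _   = refl

fibonomial-shift-≤ : ∀ m k j c d → k + j < 4 * 3 ^ m →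
  [ fibonomial (k + j + (c + d) * (4 * 3 ^ m)) (k + c * (4 * 3 ^ m)) ]
    ≡ -1₃ ^₃ (c * (k + j) + (c + d) * k) *₃ ([ binom c d ] *₃ [ fibonomial (k + j) k ])
fibonomial-shift-≤ m k j c d k+j< = begin
  [ fibonomial (k + j + (c + d) * M) (k + c * M) ]
    ≡⟨ cong (λ x → [ fibonomial x (k + c * M) ]) (split k j c d M) ⟩
  [ fibonomial (k + c * M + (j + d * M)) (k + c * M) ]
    ≡⟨ cong [_] (fibonomial-fibonom (k + c * M) (j + d * M)) ⟩
  [ fibonom (k + c * M) (j + d * M) ]
    ≡⟨ fibonom-lucas m c d (≤-<-trans (m≤m+n k j) k+j<) (≤-<-trans (m≤n+m j k) k+j<) ⟩
  -1₃ ^₃ (k * d + c * j) *₃ ([ binom c d ] *₃ [ fibonom k j ])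
    ≡⟨ cong₂ (λ x y → x *₃ ([ binom c d ] *₃ [ y ])) sign (sym (fibonomial-fibonom k j)) ⟩
  -1₃ ^₃ (c * (k + j) + (c + d) * k) *₃ ([ binom c d ] *₃ [ fibonomial (k + j) k ]) ∎
  where
  open ≡-Reasoning
  M : ℕ
  M = 4 * 3 ^ m
  split : ∀ k j c d M → k + j + (c + d) * M ≡ k + c * M + (j + d * M)
  split = ℕ-solve-∀
  parity : ∀ k j c d → k * d + c * j + 2 * (c * k) ≡ c * (k + j) + (c + d) * k
  parity = ℕ-solve-∀
  sign : -1₃ ^₃ (k * d + c * j) ≡ -1₃ ^₃ (c * (k + j) + (c + d) * k)
  sign = trans (sym (-1^-+2* (k * d + c * j) (c * k))) (cong (-1₃ ^₃_) (parity k j c d))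

fibonomial-shift-> : ∀ m {n k} c d → n < k → k < 4 * 3 ^ m →
  [ fibonomial (n + (c + d) * (4 * 3 ^ m)) (k + c * (4 * 3 ^ m)) ] ≡ 0₃
fibonomial-shift-> m {n} {k} c zero    n<k _ =
  cong [_] (fibonomial-> (subst (λ x → n + x * (4 * 3 ^ m) < k + c * (4 * 3 ^ m)) (sym (+-identityʳ c))
                                (+-monoˡ-< (c * (4 * 3 ^ m)) n<k)))
fibonomial-shift-> m {n} {k} c (suc d) n<k k< with m≤n⇒∃[o]m+o≡n (≤-trans (<⇒≤ k<) (m≤n+m (4 * 3 ^ m) n))
... | j , k+j≡n+M = begin
  [ fibonomial (n + (c + suc d) * M) (k + c * M) ]
    ≡⟨ cong (λ x → [ fibonomial x (k + c * M) ]) split ⟩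
  [ fibonomial (k + c * M + (j + d * M)) (k + c * M) ]
    ≡⟨ cong [_] (fibonomial-fibonom (k + c * M) (j + d * M)) ⟩
  [ fibonom (k + c * M) (j + d * M) ]
    ≡⟨ fibonom-lucas m c d k< j< ⟩
  -1₃ ^₃ (k * d + c * j) *₃ ([ binom c d ] *₃ [ fibonom k j ])
    ≡⟨ cong (λ x → -1₃ ^₃ (k * d + c * j) *₃ ([ binom c d ] *₃ x))
            (fibonom-carry m k< j< (subst (M ≤_) (sym k+j≡n+M) (m≤n+m M n))) ⟩
  -1₃ ^₃ (k * d + c * j) *₃ ([ binom c d ] *₃ 0₃)
    ≡⟨ *₃-zero-inner (-1₃ ^₃ (k * d + c * j)) [ binom c d ] ⟩
  0₃ ∎
  where
  open ≡-Reasoning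
  M : ℕ
  M = 4 * 3 ^ m
  j< : j < M
  j< = +-cancelˡ-< k j M (subst (_< k + M) (sym k+j≡n+M) (+-monoˡ-< M n<k))
  regroup : ∀ n c d M → n + (c + suc d) * M ≡ n + M + (c + d) * M
  regroup = ℕ-solve-∀
  shuffle : ∀ k j c d M → k + j + (c + d) * M ≡ k + c * M + (j + d * M)
  shuffle = ℕ-solve-∀
  split : n + (c + suc d) * M ≡ k + c * M + (j + d * M)
  split = trans (regroup n c d M) (trans (cong (_+ (c + d) * M) (sym k+j≡n+M)) (shuffle k j c d M))

fibonomial-shift : ∀ m {n k} c d → n < 4 * 3 ^ m → k < 4 * 3 ^ m →
  [ fibonomial (n + (c + d) * (4 * 3 ^ m)) (k + c * (4 * 3 ^ m)) ]
    ≡ -1₃ ^₃ (c * n + (c + d) * k) *₃ ([ binom c d ] *₃ [ fibonomial n k ])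
fibonomial-shift m {n} {k} c d n< k< with ≤-<-connex k n
... | inj₁ k≤n with m≤n⇒∃[o]m+o≡n k≤n
...   | j , refl = fibonomial-shift-≤ m k j c d n<
fibonomial-shift m {n} {k} c d n< k< | inj₂ n<k = begin
  [ fibonomial (n + (c + d) * (4 * 3 ^ m)) (k + c * (4 * 3 ^ m)) ]
    ≡⟨ fibonomial-shift-> m c d n<k k< ⟩
  0₃
    ≡⟨ *₃-zero-inner (-1₃ ^₃ (c * n + (c + d) * k)) [ binom c d ] ⟨
  -1₃ ^₃ (c * n + (c + d) * k) *₃ ([ binom c d ] *₃ 0₃)
    ≡⟨ cong (λ x → -1₃ ^₃ (c * n + (c + d) * k) *₃ ([ binom c d ] *₃ [ x ])) (fibonomial-> n<k) ⟨
  -1₃ ^₃ (c * n + (c + d) * k) *₃ ([ binom c d ] *₃ [ fibonomial n k ]) ∎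
  where open ≡-Reasoning

fibonomial-shift-4·3^m : ∀ m {n k} → n < 4 * 3 ^ m → k < 4 * 3 ^ m →
  [ fibonomial (n + 4 * 3 ^ m) k ] ≡ -1₃ ^₃ k *₃ [ fibonomial n k ]
fibonomial-shift-4·3^m m {n} {k} n< k< = begin
  [ fibonomial (n + 4 * 3 ^ m) k ]
    ≡⟨ cong₂ (λ x y → [ fibonomial (n + x) y ]) (sym (+-identityʳ (4 * 3 ^ m))) (sym (+-identityʳ k)) ⟩
  [ fibonomial (n + (0 + 1) * (4 * 3 ^ m)) (k + 0 * (4 * 3 ^ m)) ]
    ≡⟨ fibonomial-shift m 0 1 n< k< ⟩
  -1₃ ^₃ (k + 0) *₃ [ fibonomial n k ]
    ≡⟨ cong (λ e → -1₃ ^₃ e *₃ [ fibonomial n k ]) (+-identityʳ k) ⟩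
  -1₃ ^₃ k *₃ [ fibonomial n k ] ∎
  where open ≡-Reasoning

fibonomial-shift-8·3^m : ∀ m {n k} → n < 4 * 3 ^ m → k < 4 * 3 ^ m →
  [ fibonomial (n + 8 * 3 ^ m) k ] ≡ [ fibonomial n k ]
fibonomial-shift-8·3^m m {n} {k} n< k< = begin
  [ fibonomial (n + 8 * 3 ^ m) k ]
    ≡⟨ cong₂ (λ x y → [ fibonomial (n + x) y ]) (double (3 ^ m)) (sym (+-identityʳ k)) ⟩
  [ fibonomial (n + (0 + 2) * (4 * 3 ^ m)) (k + 0 * (4 * 3 ^ m)) ]
    ≡⟨ fibonomial-shift m 0 2 n< k< ⟩
  -1₃ ^₃ (2 * k) *₃ [ fibonomial n k ]
    ≡⟨ cong (_*₃ [ fibonomial n k ]) (-1^-+2* 0 k) ⟩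
  [ fibonomial n k ] ∎
  where
  open ≡-Reasoning
  double : ∀ x → 8 * x ≡ 2 * (4 * x)
  double = ℕ-solve-∀

fibonomial-shift-diagonal : ∀ m {n k} → n < 4 * 3 ^ m → k < 4 * 3 ^ m →
  [ fibonomial (n + 8 * 3 ^ m) (k + 4 * 3 ^ m) ] ≡ -1₃ ^₃ suc n *₃ [ fibonomial n k ]
fibonomial-shift-diagonal m {n} {k} n< k< = begin
  [ fibonomial (n + 8 * 3 ^ m) (k + 4 * 3 ^ m) ]
    ≡⟨ cong₂ (λ x y → [ fibonomial (n + x) (k + y) ]) (double (3 ^ m)) (sym (+-identityʳ (4 * 3 ^ m))) ⟩
  [ fibonomial (n + (1 + 1) * (4 * 3 ^ m)) (k + 1 * (4 * 3 ^ m)) ]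
    ≡⟨ fibonomial-shift m 1 1 n< k< ⟩
  -1₃ ^₃ (n + 0 + 2 * k) *₃ (-1₃ *₃ [ fibonomial n k ])
    ≡⟨ cong (λ x → x *₃ (-1₃ *₃ [ fibonomial n k ]))
            (trans (-1^-+2* (n + 0) k) (cong (-1₃ ^₃_) (+-identityʳ n))) ⟩
  -1₃ ^₃ n *₃ (-1₃ *₃ [ fibonomial n k ])
    ≡⟨ swap (-1₃ ^₃ n) -1₃ [ fibonomial n k ] ⟩
  -1₃ ^₃ suc n *₃ [ fibonomial n k ] ∎
  where
  open ≡-Reasoning
  double : ∀ x → 8 * x ≡ 2 * (4 * x)
  double = ℕ-solve-∀
  swap : ∀ x y z → x *₃ (y *₃ z) ≡ y *₃ x *₃ z
  swap = solve-∀ +₃-*₃-almostCommutativeRing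

[]≡0⇒3∣ : ∀ n → [ n ] ≡ 0₃ → 3 ∣ℕ n
[]≡0⇒3∣ n [n]≡0 = m%n≡0⇒n∣m n 3 (trans (sym (toℕ-[] n)) (cong toℕ [n]≡0))

[]≡⇒3∣∸ : ∀ {a b} → a ≤ b → [ a ] ≡ [ b ] → 3 ∣ℕ b ∸ a
[]≡⇒3∣∸ {a} {b} a≤b [a]≡[b] = []≡0⇒3∣ (b ∸ a) (+₃-identityʳ-unique [ a ] [ b ∸ a ] (begin
  [ a ] +₃ [ b ∸ a ]  ≡⟨ []-homo-+ a (b ∸ a) ⟨
  [ a + (b ∸ a) ]     ≡⟨ cong [_] (m+[n∸m]≡n a≤b) ⟩
  [ b ]               ≡⟨ [a]≡[b] ⟨
  [ a ]               ∎))
  where open ≡-Reasoning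

≡-mod-3 : ∀ a b → [ a ] ≡ [ b ] → (+ a) ≡ (+ b) [mod 3 ]
≡-mod-3 a b [a]≡[b] = subst (3 ∣ℕ_) (sym (cong ℤ.∣_∣ (m-n≡m⊖n a b))) 3∣∣a⊖b∣
  where
  3∣∣a⊖b∣ : 3 ∣ℕ ℤ.∣ a ℤ.⊖ b ∣
  3∣∣a⊖b∣ with ≤-total a b
  ... | inj₁ a≤b = subst (3 ∣ℕ_) (sym (∣⊖∣-≤ a≤b)) ([]≡⇒3∣∸ a≤b [a]≡[b])
  ... | inj₂ b≤a = subst (3 ∣ℕ_) (sym (trans (∣m⊖n∣≡∣n⊖m∣ a b) (∣⊖∣-≤ b≤a)))
                         ([]≡⇒3∣∸ b≤a (sym [a]≡[b]))

≡-neg-mod-3 : ∀ a b → [ a ] ≡ -₃ [ b ] → (+ a) ≡ ℤ.- (+ b) [mod 3 ]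
≡-neg-mod-3 a b [a]≡-[b] = subst (λ x → 3 ∣ℕ ℤ.∣ + a ℤ.+ x ∣) (sym (neg-involutive (+ b)))
  ([]≡0⇒3∣ (a + b) (trans ([]-homo-+ a b) (trans (cong (_+₃ [ b ]) [a]≡-[b]) (-₃-inverseˡ [ b ]))))

theorem5p1 : (m n k : ℕ) → n < 4 * 3 ^ m → k < 4 * 3 ^ m →
    ((Even k → (+ fibonomial (n + 4 * 3 ^ m) k) ≡ (+ fibonomial n k) [mod 3 ])
    × (Odd k → (+ fibonomial (n + 4 * 3 ^ m) k) ≡ ℤ.- (+ fibonomial n k) [mod 3 ]))
    × ((+ fibonomial (n + 8 * 3 ^ m) k) ≡ (+ fibonomial n k) [mod 3 ])
    × ((Even n → (+ fibonomial (n + 8 * 3 ^ m) (k + 4 * 3 ^ m)) ≡ ℤ.- (+ fibonomial n k) [mod 3 ])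
    × (Odd n → (+ fibonomial (n + 8 * 3 ^ m) (k + 4 * 3 ^ m)) ≡ (+ fibonomial n k) [mod 3 ]))
theorem5p1 m n k n< k< =
    ( (λ k-even → ≡-mod-3 F₄ F (trans shift (cong (_*₃ [ F ]) (-1^even k-even))))
    , (λ k-odd → ≡-neg-mod-3 F₄ F (trans shift (cong (_*₃ [ F ]) (-1^odd k-odd)))) )
  , ≡-mod-3 F₈ F (fibonomial-shift-8·3^m m n< k<)
  , ( (λ n-even → ≡-neg-mod-3 F₈₄ F (trans diagonal (cong (λ x → -1₃ *₃ x *₃ [ F ]) (-1^even n-even))))
    , (λ n-odd → ≡-mod-3 F₈₄ F (trans diagonal (cong (λ x → -1₃ *₃ x *₃ [ F ]) (-1^odd n-odd)))) )
  where
  F F₄ F₈ F₈₄ : ℕ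
  F = fibonomial n k
  F₄ = fibonomial (n + 4 * 3 ^ m) k
  F₈ = fibonomial (n + 8 * 3 ^ m) k
  F₈₄ = fibonomial (n + 8 * 3 ^ m) (k + 4 * 3 ^ m)
  shift : [ F₄ ] ≡ -1₃ ^₃ k *₃ [ F ]
  shift = fibonomial-shift-4·3^m m n< k<
  diagonal : [ F₈₄ ] ≡ -1₃ ^₃ suc n *₃ [ F ]
  diagonal = fibonomial-shift-diagonal m n< k<
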